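{- Let $A$ be a finite arborescence with weight functions $w:E(A)\to\mathbb{R}_{>0}$ and $c:E(A)\to\mathbb{R}_{>0}$ satisfying (i) $c(e)\le w(e)+\sum_{f\in\delta^+(y)}c(f)$ for all $e=(x,y)\in E(A)$, and (ii) $c(x,y)+c(y,z)\le w(x,y)+\sum_{f\in\delta^+(y)\setminus\{(y,z)\}}c(f)$ for all $(x,y),(y,z)\in E(A)$. Let $k\in\mathbb{R}_{>0}$, $r\in\mathbb{R}_{\ge 0}$, and $E_r=\{e=(x,y)\in E(A): r<c(e)\le \tfrac{k}{4}r \text{ and } c(f)\le \tfrac1k c(e)\ \forall f\in\delta^+(y)\}$. Then $c(E_r)\le 2\cdot w(A)$.
   Context: An arborescence is a connected directed acyclic graph in which every vertex has in-degree at most 1. $\delta^+(y)$ denotes the set of edges leaving vertex $y$. For $F\subseteq E(A)$, $c(F)=\sum_{e\in F}c(e)$, and $w(A)=\sum_{e\in E(A)}w(e)$. -}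

module Defs where

open import Level using (0ℓ)
open import Data.Nat using (ℕ; zero; suc)
open import Data.Fin using (Fin; _≟_)
open import Data.Bool using (Bool; true; false; if_then_else_)
open import Data.Product using (Σ; ∃; _×_; _,_)
open import Relation.Nullary using (¬_)
open import Relation.Nullary.Decidable using (⌊_⌋)
open import Relation.Binary using (Rel; IsTotalOrder)
open import Relation.Binary.PropositionalEquality using (_≡_; _≢_)
open import Relation.Binary.Construct.Closure.Transitive using (TransClosure)
open import Relation.Binary.Construct.Closure.ReflexiveTransitive using (Star)
open import Relation.Binary.Construct.Closure.Symmetric using (SymClosure)
open import Algebra.Structures using (IsCommutativeRing)

-- Ordered fields (stand-in for ℝ; ℝ is an instance).
-- The field is total: 0⁻¹ is some unspecified element.

record OrderedField : Set₁ where
  infixl 7 _*_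
  infixl 6 _+_
  infix 4 _≤_ _<_
  field
    Carrier : Set
    _+_ _*_ : Carrier → Carrier → Carrier
    -_ _⁻¹  : Carrier → Carrier
    0# 1#   : Carrier
    _≤_     : Rel Carrier 0ℓ
    isCommutativeRing : IsCommutativeRing _≡_ _+_ _*_ -_ 0# 1#
    0≢1     : 0# ≢ 1#
    ⁻¹-inverse : ∀ x → x ≢ 0# → x * (x ⁻¹) ≡ 1#
    isTotalOrder : IsTotalOrder _≡_ _≤_
    +-mono-≤ : ∀ {x y} z → x ≤ y → x + z ≤ y + z
    *-nonneg : ∀ {x y} → 0# ≤ x → 0# ≤ y → 0# ≤ x * y

  _<_ : Rel Carrier 0ℓ
  x < y = (x ≤ y) × (x ≢ y)

  2# 4# : Carrier
  2# = 1# + 1#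
  4# = 2# + 2#

  ∑ : (m : ℕ) → (Fin m → Carrier) → Carrier
  ∑ zero    f = 0#
  ∑ (suc m) f = f Fin.zero + ∑ m (λ i → f (Fin.suc i))

record Digraph : Set where
  field
    V E : ℕ
    src tgt : Fin E → Fin V

  Adj : Rel (Fin V) 0ℓ
  Adj u v = ∃ λ e → (src e ≡ u) × (tgt e ≡ v)

record IsArborescence (G : Digraph) : Set where
  open Digraph G
  field
    connected : ∀ u v → Star (SymClosure Adj) u v
    acyclic   : ∀ v → ¬ TransClosure Adj v v
    indeg≤1   : ∀ e f → tgt e ≡ tgt f → e ≡ f

module _ (F : OrderedField) (G : Digraph) where
  open OrderedField F
  open Digraph G

  sumOut : (Fin E → Carrier) → Fin V → Carrier
  sumOut c y = ∑ E (λ f → if ⌊ src f ≟ y ⌋ then c f else 0#)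

  sumOutExcept : (Fin E → Carrier) → Fin V → Fin E → Carrier
  sumOutExcept c y g =
    ∑ E (λ f → if ⌊ src f ≟ y ⌋ then (if ⌊ f ≟ g ⌋ then 0# else c f) else 0#)

  sumSubset : (Fin E → Bool) → (Fin E → Carrier) → Carrier
  sumSubset S c = ∑ E (λ e → if S e then c e else 0#)

  InEr : (c : Fin E → Carrier) (k r : Carrier) → Fin E → Set
  InEr c k r e = (r < c e) × (c e ≤ (k * (4# ⁻¹)) * r)
                 × (∀ f → src f ≡ tgt e → c f ≤ (k ⁻¹) * c e)

-- Charge each edge e the potential g(e) = min(2 c(e), r). Condition (i) gives
--   [e ∈ E_r] c(e) + g(e) ≤ 2 w(e) + ∑_{f ∈ δ⁺(y)} g(f)      for e = (x, y):
-- off E_r, truncate (i) doubled; on E_r, g(e) ≤ r < c(e), and every child f has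
-- c(f) ≤ c(e)/k ≤ r/4, so g(f) = 2 c(f) is not truncated. Summing over all edges,
-- in-degree at most 1 means each g(f) occurs at most once on the right, so the
-- potentials cancel.

module Submission where

open import Defs
open import Level using (0ℓ)
open import Data.Nat using (zero; suc)
open import Data.Fin using (Fin)
import Data.Fin as Fin
open import Data.Fin.Properties using (suc-injective)
open import Data.Bool using (Bool; true; false; if_then_else_)
open import Data.Product using (_,_; proj₁)
open import Data.Sum using (inj₁; inj₂; [_,_]′)
open import Data.Empty using (⊥-elim)
open import Function.Bundles using (_⇔_; Equivalence)
open import Relation.Nullary using (¬_; yes; no)
open import Relation.Nullary.Decidable using (⌊_⌋; toWitness)
open import Data.Bool.Properties using (T-≡)
open import Relation.Binary.Bundles using (TotalOrder)
open import Relation.Binary.PropositionalEquality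
  using (_≡_; _≢_; refl; sym; trans; cong; cong₂; subst₂; module ≡-Reasoning)
open import Algebra.Bundles using (CommutativeRing)
import Relation.Binary.Reasoning.PartialOrder

module OrderedFieldProperties (F : OrderedField) where
  open OrderedField F public

  commutativeRing : CommutativeRing 0ℓ 0ℓ
  commutativeRing = record { isCommutativeRing = isCommutativeRing }

  open CommutativeRing commutativeRing public using
    ( +-comm; +-assoc; +-identityˡ; +-identityʳ; -‿inverseˡ; -‿inverseʳ
    ; *-comm; *-identityˡ; distribˡ; distribʳ; zeroʳ )
  open import Algebra.Properties.Ring (CommutativeRing.ring commutativeRing) public
    using (-‿distribʳ-*; -1*x≈-x; -‿involutive)
  open import Algebra.Properties.CommutativeSemigroup
    (CommutativeRing.+-commutativeSemigroup commutativeRing) public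
    using () renaming (interchange to +-interchange)

  totalOrder : TotalOrder 0ℓ 0ℓ 0ℓ
  totalOrder = record { isTotalOrder = isTotalOrder }

  open TotalOrder totalOrder public using (total; antisym; poset)
    renaming (refl to ≤-refl; trans to ≤-trans; reflexive to ≤-reflexive)
  open import Algebra.Construct.NaturalChoice.Min totalOrder public
    using (_⊓_; x⊓y≤x; x⊓y≤y; x≤y⇒x⊓y≈x; x≤y⇒y⊓x≈x; ⊓-glb; ⊓-monoˡ-≤)
  module ≤-Reasoning = Relation.Binary.Reasoning.PartialOrder poset

  ≤-resp-≡ : ∀ {x y x′ y′} → x ≡ x′ → y ≡ y′ → x ≤ y → x′ ≤ y′
  ≤-resp-≡ = subst₂ _≤_

  +-monoʳ-≤ : ∀ {x y} z → x ≤ y → z + x ≤ z + y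
  +-monoʳ-≤ {x} {y} z x≤y = ≤-resp-≡ (+-comm x z) (+-comm y z) (+-mono-≤ z x≤y)

  +-mono₂-≤ : ∀ {a b c d} → a ≤ b → c ≤ d → a + c ≤ b + d
  +-mono₂-≤ {b = b} {c} a≤b c≤d = ≤-trans (+-mono-≤ c a≤b) (+-monoʳ-≤ b c≤d)

  x≤x+y : ∀ {y} x → 0# ≤ y → x ≤ x + y
  x≤x+y {y} x 0≤y = ≤-resp-≡ (+-identityˡ x) (+-comm y x) (+-mono-≤ x 0≤y)

  +-nonneg : ∀ {x y} → 0# ≤ x → 0# ≤ y → 0# ≤ x + y
  +-nonneg {x} 0≤x 0≤y = ≤-trans 0≤x (x≤x+y x 0≤y)

  +-cancelʳ-≤ : ∀ {x y} z → x + z ≤ y + z → x ≤ y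
  +-cancelʳ-≤ {x} {y} z p = ≤-resp-≡ (x+z-z≡x x) (x+z-z≡x y) (+-mono-≤ (- z) p)
    where
    x+z-z≡x : ∀ u → u + z + - z ≡ u
    x+z-z≡x u = trans (+-assoc u z (- z)) (trans (cong (u +_) (-‿inverseʳ z)) (+-identityʳ u))

  ≤-diff-nonneg : ∀ {x y} → x ≤ y → 0# ≤ y + - x
  ≤-diff-nonneg {x} x≤y = ≤-resp-≡ (-‿inverseʳ x) refl (+-mono-≤ (- x) x≤y)

  x≤0⇒0≤-x : ∀ {x} → x ≤ 0# → 0# ≤ - x
  x≤0⇒0≤-x {x} x≤0 = ≤-resp-≡ refl (+-identityˡ (- x)) (≤-diff-nonneg x≤0)

  *-monoˡ-≤ : ∀ {x y} z → 0# ≤ z → x ≤ y → z * x ≤ z * y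
  *-monoˡ-≤ {x} {y} z 0≤z x≤y =
    ≤-resp-≡ (+-identityˡ (z * x)) z*[y-x]+z*x≡z*y
      (+-mono-≤ (z * x) (*-nonneg 0≤z (≤-diff-nonneg x≤y)))
    where
    open ≡-Reasoning
    z*[y-x]+z*x≡z*y : z * (y + - x) + z * x ≡ z * y
    z*[y-x]+z*x≡z*y = begin
      z * (y + - x) + z * x   ≡⟨ sym (distribˡ z (y + - x) x) ⟩
      z * ((y + - x) + x)     ≡⟨ cong (z *_) (+-assoc y (- x) x) ⟩
      z * (y + (- x + x))     ≡⟨ cong (λ t → z * (y + t)) (-‿inverseˡ x) ⟩
      z * (y + 0#)            ≡⟨ cong (z *_) (+-identityʳ y) ⟩
      z * y                   ∎

  *-monoʳ-≤ : ∀ {x y} z → 0# ≤ z → x ≤ y → x * z ≤ y * z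
  *-monoʳ-≤ {x} {y} z 0≤z x≤y = ≤-resp-≡ (*-comm z x) (*-comm z y) (*-monoˡ-≤ z 0≤z x≤y)

  0≤1 : 0# ≤ 1#
  0≤1 with total 0# 1#
  ... | inj₁ 0≤1 = 0≤1
  ... | inj₂ 1≤0 = ≤-resp-≡ refl [-1]*[-1]≡1 (*-nonneg 0≤-1 0≤-1)
    where
    0≤-1 : 0# ≤ - 1#
    0≤-1 = x≤0⇒0≤-x 1≤0
    [-1]*[-1]≡1 : - 1# * - 1# ≡ 1#
    [-1]*[-1]≡1 = trans (-1*x≈-x (- 1#)) (-‿involutive 1#)

  1≰0 : ¬ (1# ≤ 0#)
  1≰0 1≤0 = 0≢1 (antisym 0≤1 1≤0)

  0≤2 : 0# ≤ 2#
  0≤2 = +-nonneg 0≤1 0≤1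

  0≤4 : 0# ≤ 4#
  0≤4 = +-nonneg 0≤2 0≤2

  4≢0 : 4# ≢ 0#
  4≢0 4≡0 = 1≰0 (≤-resp-≡ refl 4≡0 (≤-trans (x≤x+y 1# 0≤1) (x≤x+y 2# 0≤2)))

  2*x≡x+x : ∀ x → 2# * x ≡ x + x
  2*x≡x+x x = trans (distribʳ x 1# 1#) (cong₂ _+_ (*-identityˡ x) (*-identityˡ x))

  2*-nonneg : ∀ {x} → 0# ≤ x → 0# ≤ 2# * x
  2*-nonneg = *-nonneg 0≤2

  ⁻¹-nonneg : ∀ {x} → 0# ≤ x → x ≢ 0# → 0# ≤ x ⁻¹
  ⁻¹-nonneg {x} 0≤x x≢0 with total 0# (x ⁻¹)
  ... | inj₁ 0≤x⁻¹ = 0≤x⁻¹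
  ... | inj₂ x⁻¹≤0 = ⊥-elim (1≰0 (≤-resp-≡ (+-identityˡ 1#) (-‿inverseˡ 1#) (+-mono-≤ 1# 0≤-1)))
    where
    0≤-1 : 0# ≤ - 1#
    0≤-1 = ≤-resp-≡ refl (trans (sym (-‿distribʳ-* x (x ⁻¹))) (cong -_ (⁻¹-inverse x x≢0)))
             (*-nonneg 0≤x (x≤0⇒0≤-x x⁻¹≤0))

  2*4⁻¹≤1 : 2# * 4# ⁻¹ ≤ 1#
  2*4⁻¹≤1 = ≤-resp-≡ refl 2*4⁻¹+2*4⁻¹≡1 (x≤x+y (2# * 4# ⁻¹) (*-nonneg 0≤2 (⁻¹-nonneg 0≤4 4≢0)))
    where
    2*4⁻¹+2*4⁻¹≡1 : 2# * 4# ⁻¹ + 2# * 4# ⁻¹ ≡ 1#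
    2*4⁻¹+2*4⁻¹≡1 = trans (sym (distribʳ (4# ⁻¹) 2# 2#)) (⁻¹-inverse 4# 4≢0)

  ∑-cong : ∀ n {f g : Fin n → Carrier} → (∀ i → f i ≡ g i) → ∑ n f ≡ ∑ n g
  ∑-cong zero    f≗g = refl
  ∑-cong (suc n) f≗g = cong₂ _+_ (f≗g Fin.zero) (∑-cong n (λ i → f≗g (Fin.suc i)))

  ∑-mono-≤ : ∀ n {f g : Fin n → Carrier} → (∀ i → f i ≤ g i) → ∑ n f ≤ ∑ n g
  ∑-mono-≤ zero    f≤g = ≤-refl
  ∑-mono-≤ (suc n) f≤g = +-mono₂-≤ (f≤g Fin.zero) (∑-mono-≤ n (λ i → f≤g (Fin.suc i)))

  ∑-zero : ∀ n → ∑ n (λ _ → 0#) ≡ 0#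
  ∑-zero zero    = refl
  ∑-zero (suc n) = trans (cong (0# +_) (∑-zero n)) (+-identityˡ 0#)

  ∑-nonneg : ∀ n {f : Fin n → Carrier} → (∀ i → 0# ≤ f i) → 0# ≤ ∑ n f
  ∑-nonneg n 0≤f = ≤-resp-≡ (∑-zero n) refl (∑-mono-≤ n 0≤f)

  ∑-distrib-+ : ∀ n (f g : Fin n → Carrier) → ∑ n (λ i → f i + g i) ≡ ∑ n f + ∑ n g
  ∑-distrib-+ zero    f g = sym (+-identityˡ 0#)
  ∑-distrib-+ (suc n) f g =
    trans (cong (f Fin.zero + g Fin.zero +_) (∑-distrib-+ n (λ i → f (Fin.suc i)) (λ i → g (Fin.suc i))))
          (+-interchange (f Fin.zero) (g Fin.zero) _ _)

  *-distribˡ-∑ : ∀ n a (f : Fin n → Carrier) → ∑ n (λ i → a * f i) ≡ a * ∑ n f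
  *-distribˡ-∑ zero    a f = sym (zeroʳ a)
  *-distribˡ-∑ (suc n) a f =
    trans (cong (a * f Fin.zero +_) (*-distribˡ-∑ n a (λ i → f (Fin.suc i))))
          (sym (distribˡ a (f Fin.zero) _))

  ∑-comm : ∀ n m (h : Fin n → Fin m → Carrier) →
    ∑ n (λ i → ∑ m (h i)) ≡ ∑ m (λ j → ∑ n (λ i → h i j))
  ∑-comm zero    m h = sym (∑-zero m)
  ∑-comm (suc n) m h =
    trans (cong (∑ m (h Fin.zero) +_) (∑-comm n m (λ i → h (Fin.suc i))))
          (sym (∑-distrib-+ m (h Fin.zero) (λ j → ∑ n (λ i → h (Fin.suc i) j))))

  ∑-indicator-unique-≤ : ∀ n (P : Fin n → Bool) {x} → 0# ≤ x →
    (∀ i j → P i ≡ true → P j ≡ true → i ≡ j) →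
    ∑ n (λ i → if P i then x else 0#) ≤ x
  ∑-indicator-unique-≤ zero    P 0≤x unique = 0≤x
  ∑-indicator-unique-≤ (suc n) P {x} 0≤x unique with P Fin.zero in P0
  ... | true  = ≤-reflexive (trans (cong (x +_) (trans (∑-cong n rest≡0) (∑-zero n))) (+-identityʳ x))
    where
    rest≡0 : ∀ i → (if P (Fin.suc i) then x else 0#) ≡ 0#
    rest≡0 i with P (Fin.suc i) in Pi
    ... | true with () ← unique Fin.zero (Fin.suc i) P0 Pi
    ... | false = refl
  ... | false = ≤-resp-≡ (sym (+-identityˡ _)) refl
      (∑-indicator-unique-≤ n (λ i → P (Fin.suc i)) 0≤x
        (λ i j Pi Pj → suc-injective (unique (Fin.suc i) (Fin.suc j) Pi Pj)))

  if-map-0 : (h : Carrier → Carrier) → h 0# ≡ 0# →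
    ∀ b x → h (if b then x else 0#) ≡ (if b then h x else 0#)
  if-map-0 h h0≡0 true  x = refl
  if-map-0 h h0≡0 false x = h0≡0

  if-nonneg : ∀ b {x} → 0# ≤ x → 0# ≤ (if b then x else 0#)
  if-nonneg true  0≤x = 0≤x
  if-nonneg false 0≤x = ≤-refl

  module Truncation {r} (0≤r : 0# ≤ r) where

    ⊓-nonneg : ∀ {x} → 0# ≤ x → 0# ≤ x ⊓ r
    ⊓-nonneg 0≤x = ⊓-glb 0≤x 0≤r

    0⊓r≡0 : 0# ⊓ r ≡ 0#
    0⊓r≡0 = x≤y⇒x⊓y≈x 0≤r

    ⊓-subadditive : ∀ {x y} → 0# ≤ x → 0# ≤ y → (x + y) ⊓ r ≤ x ⊓ r + y ⊓ r
    ⊓-subadditive {x} {y} 0≤x 0≤y =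
      [ (λ x≤r → [ both-small x≤r , right-big ]′ (total y r)) , left-big ]′ (total x r)
      where
      both-small : x ≤ r → y ≤ r → (x + y) ⊓ r ≤ x ⊓ r + y ⊓ r
      both-small x≤r y≤r =
        ≤-resp-≡ refl (sym (cong₂ _+_ (x≤y⇒x⊓y≈x x≤r) (x≤y⇒x⊓y≈x y≤r))) (x⊓y≤x (x + y) r)
      left-big : r ≤ x → (x + y) ⊓ r ≤ x ⊓ r + y ⊓ r
      left-big r≤x = ≤-trans (x⊓y≤y (x + y) r)
        (≤-resp-≡ (x≤y⇒y⊓x≈x r≤x) refl (x≤x+y (x ⊓ r) (⊓-nonneg 0≤y)))
      right-big : r ≤ y → (x + y) ⊓ r ≤ x ⊓ r + y ⊓ r
      right-big r≤y = ≤-trans (x⊓y≤y (x + y) r)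
        (≤-resp-≡ (x≤y⇒y⊓x≈x r≤y) (+-comm (y ⊓ r) (x ⊓ r)) (x≤x+y (y ⊓ r) (⊓-nonneg 0≤x)))

    ∑-⊓-≤ : ∀ n {f : Fin n → Carrier} → (∀ i → 0# ≤ f i) → ∑ n f ⊓ r ≤ ∑ n (λ i → f i ⊓ r)
    ∑-⊓-≤ zero    0≤f = ≤-reflexive 0⊓r≡0
    ∑-⊓-≤ (suc n) 0≤f =
      ≤-trans (⊓-subadditive (0≤f Fin.zero) (∑-nonneg n (λ i → 0≤f (Fin.suc i))))
              (+-monoʳ-≤ _ (∑-⊓-≤ n (λ i → 0≤f (Fin.suc i))))

module OutSums (F : OrderedField) (A : Digraph) where
  open OrderedFieldProperties F
  open Digraph A

  ⌊≟⌋⇒≡ : ∀ {u v : Fin V} → ⌊ u Fin.≟ v ⌋ ≡ true → u ≡ v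
  ⌊≟⌋⇒≡ u≟v = toWitness (Equivalence.from T-≡ u≟v)

  sumOut-cong : ∀ {g h} y → (∀ f → src f ≡ y → g f ≡ h f) → sumOut F A g y ≡ sumOut F A h y
  sumOut-cong {g} {h} y g≗h = ∑-cong E summand≡
    where
    summand≡ : ∀ f → (if ⌊ src f Fin.≟ y ⌋ then g f else 0#) ≡ (if ⌊ src f Fin.≟ y ⌋ then h f else 0#)
    summand≡ f with src f Fin.≟ y
    ... | yes f∈δ⁺y = g≗h f f∈δ⁺y
    ... | no  _     = refl

  sumOut-nonneg : ∀ {g} y → (∀ f → 0# ≤ g f) → 0# ≤ sumOut F A g y
  sumOut-nonneg y 0≤g = ∑-nonneg E (λ f → if-nonneg ⌊ src f Fin.≟ y ⌋ (0≤g f))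

  *-distribˡ-sumOut : ∀ a g y → a * sumOut F A g y ≡ sumOut F A (λ f → a * g f) y
  *-distribˡ-sumOut a g y = trans (sym (*-distribˡ-∑ E a _))
    (∑-cong E (λ f → if-map-0 (a *_) (zeroʳ a) ⌊ src f Fin.≟ y ⌋ (g f)))

  sumOut-⊓-≤ : ∀ {r g} → 0# ≤ r → (∀ f → 0# ≤ g f) →
    ∀ y → sumOut F A g y ⊓ r ≤ sumOut F A (λ f → g f ⊓ r) y
  sumOut-⊓-≤ {r} {g} 0≤r 0≤g y = ≤-trans
    (∑-⊓-≤ E (λ f → if-nonneg ⌊ src f Fin.≟ y ⌋ (0≤g f)))
    (≤-reflexive (∑-cong E (λ f → if-map-0 (_⊓ r) 0⊓r≡0 ⌊ src f Fin.≟ y ⌋ (g f))))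
    where open Truncation 0≤r

  ∑-sumOut-tgt-≤ : (∀ e e′ → tgt e ≡ tgt e′ → e ≡ e′) → ∀ {g} → (∀ f → 0# ≤ g f) →
    ∑ E (λ e → sumOut F A g (tgt e)) ≤ ∑ E g
  ∑-sumOut-tgt-≤ indeg≤1 {g} 0≤g = begin
    ∑ E (λ e → ∑ E (λ f → if ⌊ src f Fin.≟ tgt e ⌋ then g f else 0#))
      ≡⟨ ∑-comm E E _ ⟩
    ∑ E (λ f → ∑ E (λ e → if ⌊ src f Fin.≟ tgt e ⌋ then g f else 0#))
      ≤⟨ ∑-mono-≤ E (λ f → ∑-indicator-unique-≤ E (λ e → ⌊ src f Fin.≟ tgt e ⌋) (0≤g f)
           (λ e e′ f∈δ⁺e f∈δ⁺e′ → indeg≤1 e e′ (trans (sym (⌊≟⌋⇒≡ f∈δ⁺e)) (⌊≟⌋⇒≡ f∈δ⁺e′)))) ⟩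
    ∑ E g ∎
    where open ≤-Reasoning

  ∑-≤-by-potential : (∀ e e′ → tgt e ≡ tgt e′ → e ≡ e′) →
    ∀ {s a g} → (∀ e → 0# ≤ g e) → (∀ e → s e + g e ≤ a e + sumOut F A g (tgt e)) →
    ∑ E s ≤ ∑ E a
  ∑-≤-by-potential indeg≤1 {s} {a} {g} 0≤g charge = +-cancelʳ-≤ (∑ E g) (begin
    ∑ E s + ∑ E g                                   ≡⟨ ∑-distrib-+ E s g ⟨
    ∑ E (λ e → s e + g e)                           ≤⟨ ∑-mono-≤ E charge ⟩
    ∑ E (λ e → a e + sumOut F A g (tgt e))          ≡⟨ ∑-distrib-+ E a _ ⟩
    ∑ E a + ∑ E (λ e → sumOut F A g (tgt e))        ≤⟨ +-monoʳ-≤ (∑ E a) (∑-sumOut-tgt-≤ indeg≤1 0≤g) ⟩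
    ∑ E a + ∑ E g                                   ∎)
    where open ≤-Reasoning

module Charging (F : OrderedField) (A : Digraph) where
  open OrderedFieldProperties F
  open Digraph A
  open OutSums F A
  open import Algebra.Solver.CommutativeMonoid
    (CommutativeRing.*-commutativeMonoid commutativeRing) using (solve; _⊕_; _⊜_)

  potential : (Fin E → Carrier) → Carrier → Fin E → Carrier
  potential c r e = (2# * c e) ⊓ r

  potential-nonneg : ∀ {c r} → 0# ≤ r → (∀ e → 0# < c e) → ∀ e → 0# ≤ potential c r e
  potential-nonneg 0≤r 0<c e = Truncation.⊓-nonneg 0≤r (2*-nonneg (proj₁ (0<c e)))

  InEr-child-≤ : ∀ {c k r e f} → 0# < k → 0# ≤ r → InEr F A c k r e → src f ≡ tgt e → 2# * c f ≤ r
  InEr-child-≤ {c} {k} {r} {e} {f} (0≤k , 0≢k) 0≤r (_ , ce≤kr/4 , children≤ce/k) f∈δ⁺e = begin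
    2# * c f                      ≤⟨ *-monoˡ-≤ 2# 0≤2 (children≤ce/k f f∈δ⁺e) ⟩
    2# * (k ⁻¹ * c e)             ≤⟨ *-monoˡ-≤ 2# 0≤2 (*-monoˡ-≤ (k ⁻¹) (⁻¹-nonneg 0≤k k≢0) ce≤kr/4) ⟩
    2# * (k ⁻¹ * (k * q * r))     ≡⟨ solve 5 (λ t i k q r → t ⊕ (i ⊕ ((k ⊕ q) ⊕ r)) ⊜ (k ⊕ i) ⊕ ((t ⊕ q) ⊕ r))
                                           refl 2# (k ⁻¹) k q r ⟩
    k * k ⁻¹ * (2# * q * r)       ≡⟨ cong (_* (2# * q * r)) (⁻¹-inverse k k≢0) ⟩
    1# * (2# * q * r)             ≡⟨ *-identityˡ _ ⟩
    2# * q * r                    ≤⟨ *-monoʳ-≤ r 0≤r 2*4⁻¹≤1 ⟩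
    1# * r                        ≡⟨ *-identityˡ r ⟩
    r                             ∎
    where
    open ≤-Reasoning
    q : Carrier
    q = 4# ⁻¹
    k≢0 : k ≢ 0#
    k≢0 k≡0 = 0≢k (sym k≡0)

  module _ {w c : Fin E → Carrier} {r : Carrier} (0≤r : 0# ≤ r) (0<c : ∀ e → 0# < c e)
           (cond-i : ∀ e → c e ≤ w e + sumOut F A c (tgt e)) where
    open Truncation 0≤r

    0≤c : ∀ e → 0# ≤ c e
    0≤c e = proj₁ (0<c e)

    charge-outside-Er : ∀ e → 0# ≤ w e →
      potential c r e ≤ 2# * w e + sumOut F A (potential c r) (tgt e)
    charge-outside-Er e 0≤we = begin
      (2# * c e) ⊓ r                                 ≤⟨ ⊓-monoˡ-≤ r (*-monoˡ-≤ 2# 0≤2 (cond-i e)) ⟩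
      (2# * (w e + sumOut F A c (tgt e))) ⊓ r         ≡⟨ cong (_⊓ r) (distribˡ 2# (w e) _) ⟩
      (2# * w e + 2# * sumOut F A c (tgt e)) ⊓ r      ≤⟨ ⊓-subadditive (2*-nonneg 0≤we) (2*-nonneg (sumOut-nonneg _ 0≤c)) ⟩
      (2# * w e) ⊓ r + (2# * sumOut F A c (tgt e)) ⊓ r ≤⟨ +-mono-≤ _ (x⊓y≤x (2# * w e) r) ⟩
      2# * w e + (2# * sumOut F A c (tgt e)) ⊓ r      ≡⟨ cong (λ t → 2# * w e + t ⊓ r) (*-distribˡ-sumOut 2# c (tgt e)) ⟩
      2# * w e + sumOut F A (λ f → 2# * c f) (tgt e) ⊓ r
                                                      ≤⟨ +-monoʳ-≤ _ (sumOut-⊓-≤ 0≤r (λ f → 2*-nonneg (0≤c f)) (tgt e)) ⟩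
      2# * w e + sumOut F A (potential c r) (tgt e)   ∎
      where open ≤-Reasoning

    charge-Er : ∀ {k} e → 0# < k → InEr F A c k r e →
      c e + potential c r e ≤ 2# * w e + sumOut F A (potential c r) (tgt e)
    charge-Er e 0<k e∈Er@((r≤ce , _) , _) = begin
      c e + (2# * c e) ⊓ r                            ≤⟨ +-monoʳ-≤ (c e) (≤-trans (x⊓y≤y _ r) r≤ce) ⟩
      c e + c e                                       ≡⟨ 2*x≡x+x (c e) ⟨
      2# * c e                                        ≤⟨ *-monoˡ-≤ 2# 0≤2 (cond-i e) ⟩
      2# * (w e + sumOut F A c (tgt e))               ≡⟨ distribˡ 2# (w e) _ ⟩
      2# * w e + 2# * sumOut F A c (tgt e)            ≡⟨ cong (2# * w e +_) (*-distribˡ-sumOut 2# c (tgt e)) ⟩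
      2# * w e + sumOut F A (λ f → 2# * c f) (tgt e)  ≡⟨ cong (2# * w e +_) (sumOut-cong (tgt e) children-untruncated) ⟩
      2# * w e + sumOut F A (potential c r) (tgt e)   ∎
      where
      open ≤-Reasoning
      children-untruncated : ∀ f → src f ≡ tgt e → 2# * c f ≡ potential c r f
      children-untruncated f f∈δ⁺e = sym (x≤y⇒x⊓y≈x (InEr-child-≤ 0<k 0≤r e∈Er f∈δ⁺e))

lemma12 : (F : OrderedField) (A : Digraph) → IsArborescence A →
    let open OrderedField F
        open Digraph A
    in (w c : Fin E → Carrier) →
       (∀ e → 0# < w e) → (∀ e → 0# < c e) →
       (∀ e → c e ≤ w e + sumOut F A c (tgt e)) →
       (∀ e g → src g ≡ tgt e → c e + c g ≤ w e + sumOutExcept F A c (tgt e) g) →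
       (k r : Carrier) → 0# < k → 0# ≤ r →
       (S : Fin E → Bool) → (∀ e → (S e ≡ true) ⇔ InEr F A c k r e) →
       sumSubset F A S c ≤ 2# * ∑ E w
lemma12 F A arborescence w c 0<w 0<c cond-i _ k r 0<k 0≤r S S⇔Er = begin
  sumSubset F A S c      ≤⟨ ∑-≤-by-potential indeg≤1 (potential-nonneg 0≤r 0<c) charge ⟩
  ∑ E (λ e → 2# * w e)   ≡⟨ *-distribˡ-∑ E 2# w ⟩
  2# * ∑ E w             ∎
  where
  open OrderedFieldProperties F
  open Digraph A
  open IsArborescence arborescence using (indeg≤1)
  open OutSums F A
  open Charging F A
  open ≤-Reasoning

  charge : ∀ e → (if S e then c e else 0#) + potential c r e
                   ≤ 2# * w e + sumOut F A (potential c r) (tgt e)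
  charge e with S e in e∈S
  ... | true  = charge-Er 0≤r 0<c cond-i e 0<k (Equivalence.to (S⇔Er e) e∈S)
  ... | false = ≤-resp-≡ (sym (+-identityˡ _)) refl
                  (charge-outside-Er 0≤r 0<c cond-i e (proj₁ (0<w e)))
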